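{- Let $a,\delta$ be positive integers with $a<\delta<2a$ and $\gcd(a,\delta)=1$, and put $b=a+\delta$. For $n\ge 0$ let $w_n = n + a\lfloor n/a\rfloor + b\lfloor n/\delta\rfloor$ and $g_n=w_{n+1}-w_n$. Let $n\ge0$ be an index with $g_n=a+1$, and let $\rho\in\{1,\dots,\delta-1\}$ be the residue of $n+1$ modulo $\delta$. Let $L$ be the largest integer $0\le L\le n$ such that $g_{n-1}=g_{n-2}=\cdots=g_{n-L}=1$, and let $R$ be the largest integer $R\ge0$ such that $g_{n+1}=\cdots=g_{n+R}=1$. Then $L=\min(a-1,\rho-1)$ and $R=\min(a-1,\delta-\rho-1)$. -}

module Defs where

open import Data.Nat using (ℕ; suc; _+_; _*_; _∸_; _≤_; NonZero)
open import Data.Nat.DivMod using (_/_)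
open import Data.Product using (_×_)

w : (a δ : ℕ) → .{{_ : NonZero a}} → .{{_ : NonZero δ}} → ℕ → ℕ
w a δ n = n + a * (n / a) + (a + δ) * (n / δ)

-- g_n = w_{n+1} - w_n  (w is strictly increasing, so truncated subtraction is exact)
g : (a δ : ℕ) → .{{_ : NonZero a}} → .{{_ : NonZero δ}} → ℕ → ℕ
g a δ n = w a δ (suc n) ∸ w a δ n

IsLargest : (ℕ → Set) → ℕ → Set
IsLargest P x = P x × (∀ y → P y → y ≤ x)

-- The gap g n is 1 + a·[a ∣ n+1] + b·[δ ∣ n+1], so g n = a + 1 says exactly that n + 1 is a
-- multiple of a but not of δ, and g m = 1 says that m + 1 is a multiple of neither.
-- Walking away from n + 1, the next multiple of a is a steps away on either side, while the
-- nearest multiples of δ are ρ steps to the left and δ - ρ steps to the right; the runs of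
-- unit gaps end just before the first of these.
module Submission where

open import Defs
open import Data.Nat using (ℕ; suc; s≤s; _+_; _*_; _∸_; _≤_; _<_; NonZero; _⊓_; pred; _≟_; _≤?_; ≢-nonZero⁻¹)
open import Data.Nat.DivMod
open import Data.Nat.Divisibility using (n∣m*n)
open import Data.Nat.GCD using (gcd)
open import Data.Nat.Properties
open import Data.Nat.Tactic.RingSolver using (solve-∀)
open import Data.Product using (_×_; _,_; ∃)
open import Relation.Nullary using (¬_; yes; no; contradiction)
open import Relation.Binary.PropositionalEquality
open ≡-Reasoning

[m+n]%d≡m%d+n : ∀ m n d .{{_ : NonZero d}} → m % d + n < d → (m + n) % d ≡ m % d + n
[m+n]%d≡m%d+n m n d lt = begin
  (m + n) % d               ≡⟨ %-distribˡ-+ m n d ⟩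
  (m % d + n % d) % d       ≡⟨ cong (λ r → (m % d + r) % d) (m<n⇒m%n≡m (≤-<-trans (m≤n+m n (m % d)) lt)) ⟩
  (m % d + n) % d           ≡⟨ m<n⇒m%n≡m lt ⟩
  m % d + n                 ∎

[m+n]%d≢0 : ∀ m {n} d .{{_ : NonZero d}} → 0 < n → m % d + n < d → (m + n) % d ≢ 0
[m+n]%d≢0 m {n} d 0<n lt eq =
  <⇒≢ 0<n (sym (m+n≡0⇒n≡0 (m % d) (trans (sym ([m+n]%d≡m%d+n m n d lt)) eq)))

[m∸n]%d≡0⇒m%d≡n : ∀ m {n} d .{{_ : NonZero d}} → n ≤ m → n < d → (m ∸ n) % d ≡ 0 → m % d ≡ n
[m∸n]%d≡0⇒m%d≡n m {n} d n≤m n<d eq = begin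
  m % d                     ≡⟨ cong (_% d) (m∸n+n≡m n≤m) ⟨
  (m ∸ n + n) % d           ≡⟨ [m+n]%d≡m%d+n (m ∸ n) n d (subst (λ r → r + n < d) (sym eq) n<d) ⟩
  (m ∸ n) % d + n           ≡⟨ cong (_+ n) eq ⟩
  n                         ∎

[m+[d∸m%d]]%d≡0 : ∀ m d .{{_ : NonZero d}} → (m + (d ∸ m % d)) % d ≡ 0
[m+[d∸m%d]]%d≡0 m d = begin
  (m + (d ∸ m % d)) % d                 ≡⟨ %-distribˡ-+ m (d ∸ m % d) d ⟩
  (m % d + (d ∸ m % d) % d) % d         ≡⟨ cong (λ r → (r + (d ∸ m % d) % d) % d) (m%n%n≡m%n m d) ⟨
  (m % d % d + (d ∸ m % d) % d) % d     ≡⟨ %-distribˡ-+ (m % d) (d ∸ m % d) d ⟨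
  (m % d + (d ∸ m % d)) % d             ≡⟨ cong (_% d) (m+[n∸m]≡n (m%n≤n m d)) ⟩
  d % d                                 ≡⟨ n%n≡0 d ⟩
  0                                     ∎

[m∸m%d]%d≡0 : ∀ m d .{{_ : NonZero d}} → (m ∸ m % d) % d ≡ 0
[m∸m%d]%d≡0 m d = begin
  (m ∸ m % d) % d                       ≡⟨ cong (λ x → (x ∸ m % d) % d) (m≡m%n+[m/n]*n m d) ⟩
  (m % d + m / d * d ∸ m % d) % d       ≡⟨ cong (_% d) (m+n∸m≡n (m % d) (m / d * d)) ⟩
  (m / d * d) % d                       ≡⟨ m*n%n≡0 (m / d) d ⟩
  0                                     ∎

[r+q*d]/d≡q : ∀ {r} q d .{{_ : NonZero d}} → r < d → (r + q * d) / d ≡ q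
[r+q*d]/d≡q {r} q d r<d =
  trans (+-distrib-/-∣ʳ r (n∣m*n q)) (cong₂ _+_ (m<n⇒m/n≡0 r<d) (m*n/n≡m q d))

module _ {d : ℕ} .{{_ : NonZero d}} {n : ℕ} where

  private
    [1+n]≡[1+n%d]+[n/d]*d : suc n ≡ suc (n % d) + n / d * d
    [1+n]≡[1+n%d]+[n/d]*d = cong suc (m≡m%n+[m/n]*n n d)

  [1+n]%d≡0⇒[1+n]/d≡1+n/d : suc n % d ≡ 0 → suc n / d ≡ 1 + n / d
  [1+n]%d≡0⇒[1+n]/d≡1+n/d d∣1+n = begin
    suc n / d                           ≡⟨ cong (_/ d) [1+n]≡[1+n%d]+[n/d]*d ⟩
    (suc (n % d) + n / d * d) / d       ≡⟨ cong (λ r → (suc r + n / d * d) / d) (%-pred-≡0 d∣1+n) ⟩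
    (suc (pred d) + n / d * d) / d      ≡⟨ cong (λ r → (r + n / d * d) / d) (suc-pred d) ⟩
    (suc (n / d) * d) / d               ≡⟨ m*n/n≡m (suc (n / d)) d ⟩
    1 + n / d                           ∎

  [1+n]%d≢0⇒[1+n]/d≡n/d : suc n % d ≢ 0 → suc n / d ≡ n / d
  [1+n]%d≢0⇒[1+n]/d≡n/d d∤1+n =
    trans (cong (_/ d) [1+n]≡[1+n%d]+[n/d]*d) ([r+q*d]/d≡q (n / d) d 1+n%d<d)
    where
    1+n%d<d : suc (n % d) < d
    1+n%d<d = ≤∧≢⇒< (m%n<n n d) λ 1+n%d≡d → d∤1+n (begin
      suc n % d                         ≡⟨ cong (_% d) [1+n]≡[1+n%d]+[n/d]*d ⟩
      (suc (n % d) + n / d * d) % d     ≡⟨ cong (λ r → (r + n / d * d) % d) 1+n%d≡d ⟩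
      (suc (n / d) * d) % d             ≡⟨ m*n%n≡0 (suc (n / d)) d ⟩
      0                                 ∎)

data Carry (d : ℕ) .{{_ : NonZero d}} (n : ℕ) : ℕ → Set where
  carry    : suc n % d ≡ 0 → Carry d n 1
  no-carry : suc n % d ≢ 0 → Carry d n 0

carry? : ∀ d .{{_ : NonZero d}} n → ∃ (Carry d n)
carry? d n with suc n % d ≟ 0
... | yes d∣1+n = 1 , carry d∣1+n
... | no d∤1+n  = 0 , no-carry d∤1+n

[1+n]/d≡c+n/d : ∀ {d} .{{_ : NonZero d}} {n c} → Carry d n c → suc n / d ≡ c + n / d
[1+n]/d≡c+n/d (carry d∣1+n)    = [1+n]%d≡0⇒[1+n]/d≡1+n/d d∣1+n
[1+n]/d≡c+n/d (no-carry d∤1+n) = [1+n]%d≢0⇒[1+n]/d≡n/d d∤1+n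

module _ (a δ : ℕ) .{{_ : NonZero a}} .{{_ : NonZero δ}} where

  g≡1+cₐ*a+c_δ*[a+δ] : ∀ {n cₐ c_δ} → Carry a n cₐ → Carry δ n c_δ →
                       g a δ n ≡ 1 + cₐ * a + c_δ * (a + δ)
  g≡1+cₐ*a+c_δ*[a+δ] {n} {cₐ} {c_δ} carryₐ carry_δ = begin
    w a δ (suc n) ∸ w a δ n             ≡⟨ cong (_∸ w a δ n) w[1+n] ⟩
    w a δ n + jump ∸ w a δ n            ≡⟨ m+n∸m≡n (w a δ n) jump ⟩
    jump                                ∎
    where
    jump : ℕ
    jump = 1 + cₐ * a + c_δ * (a + δ)
    regroup : ∀ n a b x y cₐ c_δ →
              suc n + a * (cₐ + x) + b * (c_δ + y) ≡ (n + a * x + b * y) + (1 + cₐ * a + c_δ * b)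
    regroup = solve-∀
    w[1+n] : w a δ (suc n) ≡ w a δ n + jump
    w[1+n] = trans (cong₂ (λ x y → suc n + a * x + (a + δ) * y)
                          ([1+n]/d≡c+n/d carryₐ) ([1+n]/d≡c+n/d carry_δ))
                   (regroup n a (a + δ) (n / a) (n / δ) cₐ c_δ)

  g≡1 : ∀ {n} → suc n % a ≢ 0 → suc n % δ ≢ 0 → g a δ n ≡ 1
  g≡1 a∤1+n δ∤1+n = g≡1+cₐ*a+c_δ*[a+δ] (no-carry a∤1+n) (no-carry δ∤1+n)

  g≡1⇒[1+n]%a≢0 : ∀ {n} → g a δ n ≡ 1 → suc n % a ≢ 0
  g≡1⇒[1+n]%a≢0 {n} gₙ≡1 a∣1+n with carry? δ n
  ... | c_δ , carry_δ = ≢-nonZero⁻¹ a (trans (sym (*-identityˡ a)) (m+n≡0⇒m≡0 (1 * a) jumps≡0))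
    where
    jumps≡0 : 1 * a + c_δ * (a + δ) ≡ 0
    jumps≡0 = suc-injective (trans (sym (g≡1+cₐ*a+c_δ*[a+δ] (carry a∣1+n) carry_δ)) gₙ≡1)

  g≡1⇒[1+n]%δ≢0 : ∀ {n} → g a δ n ≡ 1 → suc n % δ ≢ 0
  g≡1⇒[1+n]%δ≢0 {n} gₙ≡1 δ∣1+n with carry? a n
  ... | cₐ , carryₐ =
    ≢-nonZero⁻¹ a (m+n≡0⇒m≡0 a (trans (sym (*-identityˡ (a + δ))) (m+n≡0⇒n≡0 (cₐ * a) jumps≡0)))
    where
    jumps≡0 : cₐ * a + 1 * (a + δ) ≡ 0
    jumps≡0 = suc-injective (trans (sym (g≡1+cₐ*a+c_δ*[a+δ] carryₐ (carry δ∣1+n))) gₙ≡1)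

  g≡a+1⇒[1+n]%δ≢0 : ∀ {n} → g a δ n ≡ a + 1 → suc n % δ ≢ 0
  g≡a+1⇒[1+n]%δ≢0 {n} gₙ≡a+1 δ∣1+n with carry? a n
  ... | cₐ , carryₐ = ≢-nonZero⁻¹ δ (n≤0⇒n≡0 (+-cancelˡ-≤ a δ 0 a+δ≤a+0))
    where
    jumps≡a : cₐ * a + 1 * (a + δ) ≡ a
    jumps≡a = suc-injective
      (trans (sym (g≡1+cₐ*a+c_δ*[a+δ] carryₐ (carry δ∣1+n))) (trans gₙ≡a+1 (+-comm a 1)))
    a+δ≤a+0 : a + δ ≤ a + 0
    a+δ≤a+0 = subst₂ _≤_ (+-identityʳ (a + δ)) (sym (+-identityʳ a))
                (m+n≤o⇒n≤o (cₐ * a) (≤-reflexive jumps≡a))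

  g≡a+1⇒[1+n]%a≡0 : ∀ {n} → g a δ n ≡ a + 1 → suc n % a ≡ 0
  g≡a+1⇒[1+n]%a≡0 {n} gₙ≡a+1 with suc n % a ≟ 0
  ... | yes a∣1+n = a∣1+n
  ... | no a∤1+n  = contradiction (sym (suc-injective
      (trans (sym (g≡1 a∤1+n (g≡a+1⇒[1+n]%δ≢0 gₙ≡a+1))) (trans gₙ≡a+1 (+-comm a 1)))))
      (≢-nonZero⁻¹ a)

Run : (ℕ → Set) → ℕ → Set
Run P R = ∀ i → 1 ≤ i → i ≤ R → P i

run-stops-before : ∀ {P : ℕ → Set} {y k} → Run P y → 1 ≤ k → (k ≤ y → ¬ P k) → y ≤ pred k
run-stops-before {y = y} {k} run 1≤k fails with k ≤? y
... | yes k≤y = contradiction (run k 1≤k k≤y) (fails k≤y)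
... | no k≰y  = <⇒≤pred (≰⇒> k≰y)

≤pred⇒< : ∀ {i m} → 1 ≤ i → i ≤ pred m → i < m
≤pred⇒< {m = suc m} _ i≤m = s≤s i≤m
≤pred⇒< {m = 0} 1≤i i≤0 = contradiction (≤-trans 1≤i i≤0) λ ()

module _ (a δ : ℕ) .{{_ : NonZero a}} .{{_ : NonZero δ}} (n : ℕ)
         (a∣1+n : suc n % a ≡ 0) (δ∤1+n : suc n % δ ≢ 0) where

  private
    ρ : ℕ
    ρ = suc n % δ

    1≤a : 1 ≤ a
    1≤a = n≢0⇒n>0 (≢-nonZero⁻¹ a)

    ρ<δ : ρ < δ
    ρ<δ = m%n<n (suc n) δ

  left-run : IsLargest (λ L → L ≤ n × Run (λ i → g a δ (n ∸ i) ≡ 1) L) (pred a ⊓ pred ρ)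
  left-run = (L≤n , interior) , maximal
    where
    L≤n : pred a ⊓ pred ρ ≤ n
    L≤n = ≤-trans (m⊓n≤n (pred a) (pred ρ)) (pred-mono-≤ (m%n≤m (suc n) δ))

    [1+[n∸i]]%d : ∀ {i} d .{{_ : NonZero d}} → i ≤ n → suc (n ∸ i) % d ≡ (suc n ∸ i) % d
    [1+[n∸i]]%d d i≤n = cong (_% d) (sym (+-∸-assoc 1 i≤n))

    interior : Run (λ i → g a δ (n ∸ i) ≡ 1) (pred a ⊓ pred ρ)
    interior i 1≤i i≤L = g≡1 a δ
      (λ a∣ → <⇒≢ 1≤i (trans (sym a∣1+n) ([1+n]%d≡i a i<a a∣)))
      (λ δ∣ → <⇒≢ i<ρ (sym ([1+n]%d≡i δ (<-trans i<ρ ρ<δ) δ∣)))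
      where
      i≤n : i ≤ n
      i≤n = ≤-trans i≤L L≤n
      i<a : i < a
      i<a = ≤pred⇒< 1≤i (≤-trans i≤L (m⊓n≤m (pred a) (pred ρ)))
      i<ρ : i < ρ
      i<ρ = ≤pred⇒< 1≤i (≤-trans i≤L (m⊓n≤n (pred a) (pred ρ)))
      [1+n]%d≡i : ∀ d .{{_ : NonZero d}} → i < d → suc (n ∸ i) % d ≡ 0 → suc n % d ≡ i
      [1+n]%d≡i d i<d d∣ =
        [m∸n]%d≡0⇒m%d≡n (suc n) d (m≤n⇒m≤1+n i≤n) i<d (trans (sym ([1+[n∸i]]%d d i≤n)) d∣)

    maximal : ∀ y → y ≤ n × Run (λ i → g a δ (n ∸ i) ≡ 1) y → y ≤ pred a ⊓ pred ρ
    maximal y (y≤n , run) =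
      ⊓-glb (run-stops-before run 1≤a λ a≤y → a-breaks (≤-trans a≤y y≤n))
            (run-stops-before run (n≢0⇒n>0 δ∤1+n) λ ρ≤y → ρ-breaks (≤-trans ρ≤y y≤n))
      where
      a-breaks : a ≤ n → g a δ (n ∸ a) ≢ 1
      a-breaks a≤n gₙ₋ₐ≡1 = g≡1⇒[1+n]%a≢0 a δ gₙ₋ₐ≡1 (begin
        suc (n ∸ a) % a                 ≡⟨ [1+[n∸i]]%d a a≤n ⟩
        (suc n ∸ a) % a                 ≡⟨ m≤n⇒[n∸m]%m≡n%m (m≤n⇒m≤1+n a≤n) ⟩
        suc n % a                       ≡⟨ a∣1+n ⟩
        0                               ∎)
      ρ-breaks : ρ ≤ n → g a δ (n ∸ ρ) ≢ 1
      ρ-breaks ρ≤n gₙ₋ρ≡1 =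
        g≡1⇒[1+n]%δ≢0 a δ gₙ₋ρ≡1 (trans ([1+[n∸i]]%d δ ρ≤n) ([m∸m%d]%d≡0 (suc n) δ))

  right-run : IsLargest (Run (λ i → g a δ (n + i) ≡ 1)) (pred a ⊓ pred (δ ∸ ρ))
  right-run = interior , maximal
    where
    interior : Run (λ i → g a δ (n + i) ≡ 1) (pred a ⊓ pred (δ ∸ ρ))
    interior i 1≤i i≤R = g≡1 a δ
      ([m+n]%d≢0 (suc n) a 1≤i (subst (λ r → r + i < a) (sym a∣1+n) i<a))
      ([m+n]%d≢0 (suc n) δ 1≤i ρ+i<δ)
      where
      i<a : i < a
      i<a = ≤pred⇒< 1≤i (≤-trans i≤R (m⊓n≤m (pred a) (pred (δ ∸ ρ))))
      ρ+i<δ : ρ + i < δ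
      ρ+i<δ = subst (ρ + i <_) (m+[n∸m]≡n (<⇒≤ ρ<δ))
                (+-monoʳ-< ρ (≤pred⇒< 1≤i (≤-trans i≤R (m⊓n≤n (pred a) (pred (δ ∸ ρ))))))

    maximal : ∀ y → Run (λ i → g a δ (n + i) ≡ 1) y → y ≤ pred a ⊓ pred (δ ∸ ρ)
    maximal y run =
      ⊓-glb (run-stops-before run 1≤a λ _ → a-breaks)
            (run-stops-before run (m<n⇒0<n∸m ρ<δ) λ _ → δ∸ρ-breaks)
      where
      a-breaks : g a δ (n + a) ≢ 1
      a-breaks gₙ₊ₐ≡1 = g≡1⇒[1+n]%a≢0 a δ gₙ₊ₐ≡1 (trans ([m+n]%n≡m%n (suc n) a) a∣1+n)
      δ∸ρ-breaks : g a δ (n + (δ ∸ ρ)) ≢ 1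
      δ∸ρ-breaks gₙ₊δ∸ρ≡1 = g≡1⇒[1+n]%δ≢0 a δ gₙ₊δ∸ρ≡1 ([m+[d∸m%d]]%d≡0 (suc n) δ)

lemma4p4 : (a δ : ℕ) → .{{_ : NonZero a}} → .{{_ : NonZero δ}} →
           a < δ → δ < 2 * a → gcd a δ ≡ 1 →
           (n : ℕ) → g a δ n ≡ a + 1 →
           IsLargest (λ L → L ≤ n × (∀ i → 1 ≤ i → i ≤ L → g a δ (n ∸ i) ≡ 1))
                     ((a ∸ 1) ⊓ ((suc n % δ) ∸ 1))
           × IsLargest (λ R → ∀ i → 1 ≤ i → i ≤ R → g a δ (n + i) ≡ 1)
                       ((a ∸ 1) ⊓ (δ ∸ (suc n % δ) ∸ 1))
lemma4p4 a δ _ _ _ n gₙ≡a+1 = left-run a δ n a∣1+n δ∤1+n , right-run a δ n a∣1+n δ∤1+n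
  where
  a∣1+n : suc n % a ≡ 0
  a∣1+n = g≡a+1⇒[1+n]%a≡0 a δ gₙ≡a+1
  δ∤1+n : suc n % δ ≢ 0
  δ∤1+n = g≡a+1⇒[1+n]%δ≢0 a δ gₙ≡a+1
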